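{- Let $\mathcal{H}$ be an $n$-vertex linear hypergraph with $e(\mathcal{H})$ edges, and let $t := e(\mathcal{H}) - n$. If $e_1, \dots, e_{2t} \in \mathcal{H}$ are distinct, pairwise intersecting edges such that $\{e_{2i-1}, e_{2i}\}$ is a useful pair for each $i \in [t]$, then $\mathcal{H}$ has a proper edge-colouring with $n$ colours in which each colour is assigned to at most two edges.
   Context: A hypergraph has a finite vertex set and a set of (non-repeated) nonempty subsets as edges; it is linear if distinct edges share at most one vertex. For an edge $e$, $N(e)$ denotes the set of edges $f \ne e$ with $f \cap e \neq \varnothing$. In an $n$-vertex hypergraph, a pair $\{e,f\}$ of edges is useful if $e \ne f$, $e \cap f \ne \varnothing$, and $|N(e) \cap N(f)| \le n-2$. A proper edge-colouring gives intersecting distinct edges different colours. -}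

module Defs where

open import Data.Nat using (ℕ; _+_; _≤_)
open import Data.Fin using (Fin; _≟_)
open import Data.Fin.Subset using (Subset; _∩_; Nonempty; ∣_∣)
open import Data.Fin.Subset.Properties using (nonempty?)
open import Data.List using (List; length; filter; allFin)
open import Data.Product using (_×_)
open import Relation.Nullary using (¬_; Dec; yes; no)
open import Relation.Nullary.Decidable using (_×-dec_; ¬?)
open import Relation.Unary using (Pred; Decidable)
open import Relation.Binary.PropositionalEquality using (_≡_; _≢_)
open import Function.Definitions using (Injective)
open import Level using (0ℓ)

count : ∀ {m} {P : Pred (Fin m) 0ℓ} → Decidable P → ℕ
count {m} P? = length (filter P? (allFin m))

record Hypergraph (n : ℕ) : Set where
  field
    m        : ℕ
    edge     : Fin m → Subset n
    distinct : Injective _≡_ _≡_ edge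
    nonempty : ∀ i → Nonempty (edge i)

module _ {n : ℕ} (H : Hypergraph n) where
  open Hypergraph H

  e : ℕ
  e = m

  Meets : Fin m → Fin m → Set
  Meets i j = Nonempty (edge i ∩ edge j)

  meets? : ∀ i j → Dec (Meets i j)
  meets? i j = nonempty? (edge i ∩ edge j)

  Linear : Set
  Linear = ∀ i j → i ≢ j → ∣ edge i ∩ edge j ∣ ≤ 1

  InN : Fin m → Fin m → Set
  InN i g = ¬ (g ≡ i) × Meets g i

  inN? : ∀ i g → Dec (InN i g)
  inN? i g = ¬? (g ≟ i) ×-dec meets? g i

  commonNbrs : Fin m → Fin m → ℕ
  commonNbrs i j = count (λ g → inN? i g ×-dec inN? j g)

  -- useful pair {i, j}:  i ≠ j, i ∩ j ≠ ∅, |N(i) ∩ N(j)| ≤ n - 2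
  -- (written as |N(i) ∩ N(j)| + 2 ≤ n to avoid truncated subtraction)
  Useful : Fin m → Fin m → Set
  Useful i j = i ≢ j × Meets i j × commonNbrs i j + 2 ≤ n

  ProperColouring : ∀ {k} → (Fin m → Fin k) → Set
  ProperColouring c = ∀ i j → i ≢ j → Meets i j → c i ≢ c j

  AtMostTwoPerColour : ∀ {k} → (Fin m → Fin k) → Set
  AtMostTwoPerColour c = ∀ col → count (λ i → c i ≟ col) ≤ 2

module Submission where

open import Defs
open import Data.Nat using (ℕ; zero; suc; _∸_; _+_; _≤_; _<_; z≤n; s≤s)
open import Data.Nat.Properties
  using (≤-trans; ≤-reflexive; n≤1+n; +-suc; +-comm; +-mono-≤; +-monoˡ-≤; +-monoʳ-≤;
         +-cancelʳ-≤; <⇒≱; m≤n+m∸n; m≤n+o⇒m∸n≤o)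
open import Data.Fin using (Fin; zero; suc; _≟_; inject≤)
open import Data.Fin.Properties using (¬Fin0; any?; injective⇒≤; inject≤-injective; suc-injective; 0≢1+n)
open import Data.Fin.Subset.Properties using (x∈p∩q⁺; x∈p∩q⁻)
open import Data.Sum using ([_,_]′; _⊎_; inj₁; inj₂)
open import Data.Product using (Σ; _×_; _,_; ∃; proj₁; proj₂)
open import Data.List using (length; filter; tabulate)
open import Data.Empty using (⊥-elim)
open import Function using (_∘_; id)
open import Relation.Nullary using (¬_; yes; no)
open import Relation.Nullary.Decidable using (_×-dec_; _⊎-dec_; ¬?)
open import Relation.Unary using (Pred; Decidable)
open import Relation.Binary.PropositionalEquality using (_≡_; _≢_; refl; sym; trans; cong; subst; subst₂)
open import Function.Definitions using (Injective)
open import Level using (0ℓ)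

-- Each useful pair {a i, b i} is met by at most n edges, so at least m ∸ n = t edges avoid
-- one of its members; a greedy choice makes these distinct edges g i, and each g i avoids
-- some x i ∈ {a i, b i}. The x i are distinct, and no g i is an x j because every x j meets
-- both a i and b i. Colouring each pair {g i, x i} with one colour and every other edge
-- with its own colour uses m ∸ t ≤ n colours.

-- `count` by recursion on the domain, which is what the inductive proofs below need.
count′ : ∀ {m} {P : Pred (Fin m) 0ℓ} → Decidable P → ℕ
count′ {zero}  P? = 0
count′ {suc m} P? with P? zero
... | yes _ = suc (count′ (P? ∘ suc))
... | no  _ = count′ (P? ∘ suc)

module _ {m : ℕ} {P : Pred (Fin m) 0ℓ} where

  count-tabulate : ∀ {k} (P? : Decidable P) (f : Fin k → Fin m) →
                   length (filter P? (tabulate f)) ≡ count′ (P? ∘ f)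
  count-tabulate {zero}  P? f = refl
  count-tabulate {suc k} P? f with P? (f zero)
  ... | yes _ = cong suc (count-tabulate P? (f ∘ suc))
  ... | no  _ = count-tabulate P? (f ∘ suc)

  count≡count′ : (P? : Decidable P) → count P? ≡ count′ P?
  count≡count′ P? = count-tabulate P? id

count′-none : ∀ {m} {P : Pred (Fin m) 0ℓ} (P? : Decidable P) → (∀ x → ¬ P x) → count′ P? ≡ 0
count′-none {zero}  P? none = refl
count′-none {suc m} P? none with P? zero
... | yes p = ⊥-elim (none zero p)
... | no  _ = count′-none (P? ∘ suc) (none ∘ suc)

count′-≤1 : ∀ {m} {P : Pred (Fin m) 0ℓ} (P? : Decidable P) → (∀ {x y} → P x → P y → x ≡ y) → count′ P? ≤ 1
count′-≤1 {zero}  P? uniq = z≤n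
count′-≤1 {suc m} P? uniq with P? zero
... | yes p = s≤s (≤-reflexive (count′-none (P? ∘ suc) (λ x q → 0≢1+n (uniq p q))))
... | no  _ = count′-≤1 (P? ∘ suc) (λ p q → suc-injective (uniq p q))

count′-≟≤1 : ∀ {m} (u : Fin m) → count′ (_≟ u) ≤ 1
count′-≟≤1 u = count′-≤1 (_≟ u) (λ p q → trans p (sym q))

count′-⊎ : ∀ {m} {P Q R : Pred (Fin m) 0ℓ} (R? : Decidable R) (P? : Decidable P) (Q? : Decidable Q) →
           (∀ x → R x → P x ⊎ Q x) → count′ R? ≤ count′ P? + count′ Q?
count′-⊎ {zero}  R? P? Q? split = z≤n
count′-⊎ {suc m} R? P? Q? split
  with ih ← count′-⊎ (R? ∘ suc) (P? ∘ suc) (Q? ∘ suc) (split ∘ suc) | R? zero | P? zero | Q? zero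
... | yes _ | yes _ | yes _ = s≤s (≤-trans ih (+-monoʳ-≤ _ (n≤1+n _)))
... | yes _ | yes _ | no  _ = s≤s ih
... | yes _ | no  _ | yes _ = ≤-trans (s≤s ih) (≤-reflexive (sym (+-suc _ _)))
... | yes r | no ¬p | no ¬q = ⊥-elim ([ ¬p , ¬q ]′ (split zero r))
... | no  _ | yes _ | yes _ = ≤-trans ih (+-mono-≤ (n≤1+n _) (n≤1+n _))
... | no  _ | yes _ | no  _ = ≤-trans ih (n≤1+n _)
... | no  _ | no  _ | yes _ = ≤-trans ih (+-monoʳ-≤ _ (n≤1+n _))
... | no  _ | no  _ | no  _ = ih

count′-complement : ∀ {m} {P : Pred (Fin m) 0ℓ} (P? : Decidable P) → count′ P? + count′ (¬? ∘ P?) ≡ m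
count′-complement {zero}  P? = refl
count′-complement {suc m} P? with ih ← count′-complement (P? ∘ suc) | P? zero
... | yes _ = cong suc ih
... | no  _ = trans (+-suc _ _) (cong suc ih)

count′-image≤ : ∀ {m k} {P : Pred (Fin m) 0ℓ} (P? : Decidable P) (f : Fin k → Fin m) →
                (∀ x → P x → ∃ λ j → f j ≡ x) → count′ P? ≤ k
count′-image≤ {k = zero} P? f onto =
  ≤-reflexive (count′-none P? (λ x p → ¬Fin0 (proj₁ (onto x p))))
count′-image≤ {k = suc k} {P} P? f onto =
  ≤-trans (count′-⊎ P? (_≟ f zero) Rest? split)
          (+-mono-≤ (count′-≟≤1 (f zero)) (count′-image≤ Rest? (f ∘ suc) onto-rest))
  where
  Rest? : Decidable (λ x → P x × x ≢ f zero)
  Rest? x = P? x ×-dec ¬? (x ≟ f zero)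
  split : ∀ x → P x → x ≡ f zero ⊎ (P x × x ≢ f zero)
  split x p with x ≟ f zero
  ... | yes eq = inj₁ eq
  ... | no  ne = inj₂ (p , ne)
  onto-rest : ∀ x → P x × x ≢ f zero → ∃ λ j → f (suc j) ≡ x
  onto-rest x (p , ne) with onto x p
  ... | zero  , eq = ⊥-elim (ne (sym eq))
  ... | suc j , eq = j , eq

rank : ∀ {m} {P : Pred (Fin m) 0ℓ} (P? : Decidable P) (x : Fin m) → P x → Fin (count′ P?)
rank {suc m} P? x       p with P? zero
rank {suc m} P? zero    p | yes _  = zero
rank {suc m} P? (suc x) p | yes _  = suc (rank (P? ∘ suc) x p)
rank {suc m} P? zero    p | no  ¬p = ⊥-elim (¬p p)
rank {suc m} P? (suc x) p | no  _  = rank (P? ∘ suc) x p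

rank-injective : ∀ {m} {P : Pred (Fin m) 0ℓ} (P? : Decidable P) {x y : Fin m} (p : P x) (q : P y) →
                 rank P? x p ≡ rank P? y q → x ≡ y
rank-injective {suc m} P? {x} {y} p q eq with P? zero
rank-injective {suc m} P? {zero}  {zero}  p q eq  | yes _  = refl
rank-injective {suc m} P? {suc x} {suc y} p q eq  | yes _  =
  cong suc (rank-injective (P? ∘ suc) p q (suc-injective eq))
rank-injective {suc m} P? {zero}  {_}     p q eq  | no  ¬p = ⊥-elim (¬p p)
rank-injective {suc m} P? {suc x} {zero}  p q eq  | no  ¬q = ⊥-elim (¬q q)
rank-injective {suc m} P? {suc x} {suc y} p q eq  | no  _  =
  cong suc (rank-injective (P? ∘ suc) p q eq)

count′-injective≥ : ∀ {m k} {P : Pred (Fin m) 0ℓ} (P? : Decidable P) (f : Fin k → Fin m) →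
                    Injective _≡_ _≡_ f → (∀ j → P (f j)) → k ≤ count′ P?
count′-injective≥ P? f f-inj Pf =
  injective⇒≤ (λ eq → f-inj (rank-injective P? (Pf _) (Pf _) eq))

fresh-witness : ∀ {m k} {P : Pred (Fin m) 0ℓ} (P? : Decidable P) → k < count′ P? →
                (f : Fin k → Fin m) → ∃ λ x → P x × (∀ j → f j ≢ x)
fresh-witness {P = P} P? k<count f with any? (λ x → P? x ×-dec ¬? (any? (λ j → f j ≟ x)))
... | yes (x , p , ∉f) = x , p , (λ j eq → ∉f (j , eq))
... | no  none         = ⊥-elim (<⇒≱ k<count (count′-image≤ P? f onto))
  where
  onto : ∀ x → P x → ∃ λ j → f j ≡ x
  onto x p with any? (λ j → f j ≟ x)
  ... | yes found = found
  ... | no  ∉f    = ⊥-elim (none (x , p , ∉f))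

distinct-representatives : ∀ {k m} {P : Fin k → Pred (Fin m) 0ℓ} (P? : ∀ i → Decidable (P i)) →
  (∀ i → k ≤ count′ (P? i)) → Σ (Fin k → Fin m) λ g → Injective _≡_ _≡_ g × (∀ i → P i (g i))
distinct-representatives {zero} P? large = (λ ()) , (λ { {()} }) , (λ ())
distinct-representatives {suc k} {m} {P} P? large
  with g′ , g′-inj , g′-ok ← distinct-representatives (P? ∘ suc) (λ i → ≤-trans (n≤1+n k) (large (suc i)))
  with x , px , x∉g′ ← fresh-witness (P? zero) (large zero) g′ = g , g-inj , g-ok
  where
  g : Fin (suc k) → Fin m
  g zero    = x
  g (suc i) = g′ i
  g-inj : Injective _≡_ _≡_ g
  g-inj {zero}  {zero}  eq = refl
  g-inj {zero}  {suc j} eq = ⊥-elim (x∉g′ j (sym eq))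
  g-inj {suc i} {zero}  eq = ⊥-elim (x∉g′ i eq)
  g-inj {suc i} {suc j} eq = cong suc (g′-inj eq)
  g-ok : ∀ i → P i (g i)
  g-ok zero    = px
  g-ok (suc i) = g′-ok i

module MergePairs {m t n : ℕ} (g x : Fin t → Fin m)
  (g-inj : Injective _≡_ _≡_ g) (x-inj : Injective _≡_ _≡_ x) (g≢x : ∀ i j → g i ≢ x j)
  (m≤n+t : m ≤ n + t) where

  Paired : Fin m → Fin m → Set
  Paired y z = ∃ λ j → y ≡ g j × z ≡ x j

  private
    InImage? : Decidable (λ y → ∃ λ j → x j ≡ y)
    InImage? y = any? (λ j → x j ≟ y)

    Representative? : Decidable (λ y → ¬ ∃ λ j → x j ≡ y)
    Representative? = ¬? ∘ InImage?

    rep : Fin m → Fin m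
    rep y with InImage? y
    ... | yes (j , _) = g j
    ... | no  _       = y

    rep-representative : ∀ y → ¬ ∃ λ j → x j ≡ rep y
    rep-representative y with InImage? y
    ... | yes (j , _) = λ (k , xk≡gj) → g≢x j k (sym xk≡gj)
    ... | no  y∉x     = y∉x

    rep-fibre : ∀ {z r} → rep z ≡ r → z ≡ r ⊎ ∃ λ j → z ≡ x j × g j ≡ r
    rep-fibre {z} eq with InImage? z
    ... | yes (j , xj≡z) = inj₂ (j , sym xj≡z , eq)
    ... | no  _          = inj₁ eq

    representatives≤n : count′ Representative? ≤ n
    representatives≤n = +-cancelʳ-≤ t _ n (begin
      count′ Representative? + t                    ≤⟨ +-monoʳ-≤ _ (count′-injective≥ InImage? x x-inj (λ j → j , refl)) ⟩
      count′ Representative? + count′ InImage?      ≡⟨ +-comm (count′ Representative?) _ ⟩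
      count′ InImage? + count′ Representative?      ≡⟨ count′-complement InImage? ⟩
      m                                             ≤⟨ m≤n+t ⟩
      n + t                                         ∎)
      where open Data.Nat.Properties.≤-Reasoning

  colour : Fin m → Fin n
  colour y = inject≤ (rank Representative? (rep y) (rep-representative y)) representatives≤n

  private
    colour-rep : ∀ {y z} → colour y ≡ colour z → rep y ≡ rep z
    colour-rep {y} {z} eq =
      rank-injective Representative? (rep-representative y) (rep-representative z)
                     (inject≤-injective _ _ _ _ eq)

  colour-≡⇒paired : ∀ {y z} → y ≢ z → colour y ≡ colour z → Paired y z ⊎ Paired z y
  colour-≡⇒paired {y} {z} y≢z eq with rep-fibre (colour-rep eq) | rep-fibre {z} refl
  ... | inj₁ y≡r              | inj₁ z≡r              = ⊥-elim (y≢z (trans y≡r (sym z≡r)))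
  ... | inj₁ y≡r              | inj₂ (k , z≡xk , gk≡r) = inj₁ (k , trans y≡r (sym gk≡r) , z≡xk)
  ... | inj₂ (j , y≡xj , gj≡r) | inj₁ z≡r              = inj₂ (j , trans z≡r (sym gj≡r) , y≡xj)
  ... | inj₂ (j , y≡xj , gj≡r) | inj₂ (k , z≡xk , gk≡r) =
    ⊥-elim (y≢z (trans y≡xj (trans (cong x (g-inj (trans gj≡r (sym gk≡r)))) (sym z≡xk))))

  colour-fibre≤2 : ∀ col → count′ (λ y → colour y ≟ col) ≤ 2
  colour-fibre≤2 col with any? (λ y → colour y ≟ col)
  ... | no  empty     = ≤-trans (≤-reflexive (count′-none _ (λ y eq → empty (y , eq)))) z≤n
  ... | yes (y , cy) = ≤-trans (count′-⊎ (λ z → colour z ≟ col) (_≟ rep y) Partner? split)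
                                (+-mono-≤ (count′-≟≤1 (rep y)) (count′-≤1 Partner? partner-unique))
    where
    Partner? : Decidable (λ z → ∃ λ j → z ≡ x j × g j ≡ rep y)
    Partner? z = any? (λ j → z ≟ x j ×-dec g j ≟ rep y)
    partner-unique : ∀ {z z′} → (∃ λ j → z ≡ x j × g j ≡ rep y) → (∃ λ j → z′ ≡ x j × g j ≡ rep y) → z ≡ z′
    partner-unique (j , z≡xj , gj≡r) (k , z′≡xk , gk≡r) =
      trans z≡xj (trans (cong x (g-inj (trans gj≡r (sym gk≡r)))) (sym z′≡xk))
    split : ∀ z → colour z ≡ col → z ≡ rep y ⊎ ∃ λ j → z ≡ x j × g j ≡ rep y
    split z cz = rep-fibre (colour-rep (trans cz (sym cy)))

module _ {n : ℕ} (H : Hypergraph n) where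
  open Hypergraph H

  meets-refl : ∀ i → Meets H i i
  meets-refl i with v , v∈i ← nonempty i = v , x∈p∩q⁺ (v∈i , v∈i)

  meets-sym : ∀ {i j} → Meets H i j → Meets H j i
  meets-sym {i} {j} (v , v∈i∩j) with v∈i , v∈j ← x∈p∩q⁻ (edge i) (edge j) v∈i∩j = v , x∈p∩q⁺ (v∈j , v∈i)

  MeetsBoth : Fin m → Fin m → Pred (Fin m) 0ℓ
  MeetsBoth i j h = Meets H h i × Meets H h j

  meetsBoth? : ∀ i j → Decidable (MeetsBoth i j)
  meetsBoth? i j h = meets? H h i ×-dec meets? H h j

  -- Besides i and j themselves, an edge meeting both lies in N(i) ∩ N(j).
  useful⇒meetsBoth≤n : ∀ {i j} → Useful H i j → count′ (meetsBoth? i j) ≤ n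
  useful⇒meetsBoth≤n {i} {j} (_ , _ , common+2≤n) = begin
    count′ (meetsBoth? i j)                           ≤⟨ count′-⊎ _ (_≟ i) Rest? split ⟩
    count′ (_≟ i) + count′ Rest?                      ≤⟨ +-mono-≤ (count′-≟≤1 i) (count′-⊎ Rest? (_≟ j) Common? (λ _ → id)) ⟩
    1 + (count′ (_≟ j) + count′ Common?)              ≤⟨ +-monoʳ-≤ 1 (+-mono-≤ (count′-≟≤1 j) (≤-reflexive (sym (count≡count′ Common?)))) ⟩
    2 + commonNbrs H i j                              ≡⟨ +-comm 2 _ ⟩
    commonNbrs H i j + 2                              ≤⟨ common+2≤n ⟩
    n                                                 ∎
    where
    open Data.Nat.Properties.≤-Reasoning
    Common? : Decidable (λ h → InN H i h × InN H j h)
    Common? h = inN? H i h ×-dec inN? H j h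
    Rest? : Decidable (λ h → h ≡ j ⊎ (InN H i h × InN H j h))
    Rest? h = (h ≟ j) ⊎-dec Common? h
    split : ∀ h → MeetsBoth i j h → h ≡ i ⊎ (h ≡ j ⊎ (InN H i h × InN H j h))
    split h (h∩i , h∩j) with h ≟ i | h ≟ j
    ... | yes h≡i | _       = inj₁ h≡i
    ... | no  _   | yes h≡j = inj₂ (inj₁ h≡j)
    ... | no  h≢i | no  h≢j = inj₂ (inj₂ ((h≢i , h∩i) , (h≢j , h∩j)))

  useful⇒avoidsOne≥ : ∀ {i j} → Useful H i j → m ∸ n ≤ count′ (¬? ∘ meetsBoth? i j)
  useful⇒avoidsOne≥ {i} {j} useful = m≤n+o⇒m∸n≤o m n (begin
    m                                                         ≡⟨ sym (count′-complement (meetsBoth? i j)) ⟩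
    count′ (meetsBoth? i j) + count′ (¬? ∘ meetsBoth? i j)    ≤⟨ +-monoˡ-≤ _ (useful⇒meetsBoth≤n useful) ⟩
    n + count′ (¬? ∘ meetsBoth? i j)                          ∎)
    where open Data.Nat.Properties.≤-Reasoning

  pairs⇒colouring : ∀ {t} (g x : Fin t → Fin m) → Injective _≡_ _≡_ g → Injective _≡_ _≡_ x →
    (∀ i j → g i ≢ x j) → (∀ i → ¬ Meets H (g i) (x i)) → m ≤ n + t →
    Σ (Fin m → Fin n) (λ c → ProperColouring H c × AtMostTwoPerColour H c)
  pairs⇒colouring g x g-inj x-inj g≢x g∩x≡∅ m≤n+t = colour , proper , atMostTwo
    where
    open MergePairs g x g-inj x-inj g≢x m≤n+t
    proper : ProperColouring H colour
    proper y z y≢z y∩z c≡ with colour-≡⇒paired y≢z c≡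
    ... | inj₁ (j , y≡gj , z≡xj) = g∩x≡∅ j (subst₂ (Meets H) y≡gj z≡xj y∩z)
    ... | inj₂ (j , z≡gj , y≡xj) = g∩x≡∅ j (subst₂ (Meets H) z≡gj y≡xj (meets-sym y∩z))
    atMostTwo : AtMostTwoPerColour H colour
    atMostTwo col = subst (_≤ 2) (sym (count≡count′ (λ y → colour y ≟ col))) (colour-fibre≤2 col)

module UsefulPairs {n : ℕ} (H : Hypergraph n) (a b : Fin (e H ∸ n) → Fin (Hypergraph.m H))
  (ab-inj : Injective _≡_ _≡_ [ a , b ]′)
  (ab-intersecting : ∀ s s′ → s ≢ s′ → Meets H ([ a , b ]′ s) ([ a , b ]′ s′))
  (useful : ∀ i → Useful H (a i) (b i)) where

  open Hypergraph H

  private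
    t : ℕ
    t = m ∸ n

    ab : Fin t ⊎ Fin t → Fin m
    ab = [ a , b ]′

    ab-meets : ∀ s s′ → Meets H (ab s) (ab s′)
    ab-meets s s′ with ab s ≟ ab s′
    ... | yes eq = subst (Meets H (ab s)) eq (meets-refl H (ab s))
    ... | no  ne = ab-intersecting s s′ (ne ∘ cong ab)

    representatives : Σ (Fin t → Fin m) λ g → Injective _≡_ _≡_ g × (∀ i → ¬ MeetsBoth H (a i) (b i) (g i))
    representatives = distinct-representatives (λ i → ¬? ∘ meetsBoth? H (a i) (b i))
                                                (λ i → useful⇒avoidsOne≥ H (useful i))

  g : Fin t → Fin m
  g = proj₁ representatives

  g-injective : Injective _≡_ _≡_ g
  g-injective = proj₁ (proj₂ representatives)

  private
    g-avoids-one : ∀ i → ¬ MeetsBoth H (a i) (b i) (g i)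
    g-avoids-one = proj₂ (proj₂ representatives)

    index : Fin t ⊎ Fin t → Fin t
    index = [ id , id ]′

    avoided : ∀ i → Σ (Fin t ⊎ Fin t) λ s → index s ≡ i × ¬ Meets H (g i) (ab s)
    avoided i with meets? H (g i) (a i)
    ... | yes g∩a = inj₂ i , refl , (λ g∩b → g-avoids-one i (g∩a , g∩b))
    ... | no  g∩a≡∅ = inj₁ i , refl , g∩a≡∅

  x : Fin t → Fin m
  x i = ab (proj₁ (avoided i))

  x-avoids-g : ∀ i → ¬ Meets H (g i) (x i)
  x-avoids-g i = proj₂ (proj₂ (avoided i))

  x-injective : Injective _≡_ _≡_ x
  x-injective {i} {j} eq = begin
    i                          ≡⟨ sym (proj₁ (proj₂ (avoided i))) ⟩
    index (proj₁ (avoided i))  ≡⟨ cong index (ab-inj {proj₁ (avoided i)} {proj₁ (avoided j)} eq) ⟩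
    index (proj₁ (avoided j))  ≡⟨ proj₁ (proj₂ (avoided j)) ⟩
    j                          ∎
    where open Relation.Binary.PropositionalEquality.≡-Reasoning

  -- x j meets both a i and b i, which g i does not.
  g≢x : ∀ i j → g i ≢ x j
  g≢x i j gi≡xj = g-avoids-one i
    ( subst (λ h → Meets H h (a i)) (sym gi≡xj) (ab-meets (proj₁ (avoided j)) (inj₁ i))
    , subst (λ h → Meets H h (b i)) (sym gi≡xj) (ab-meets (proj₁ (avoided j)) (inj₂ i)))

proposition5p3 : (n : ℕ) (H : Hypergraph n) → Linear H →
    (a b : Fin (e H ∸ n) → Fin (Hypergraph.m H)) →
    Injective _≡_ _≡_ [ a , b ]′ →
    (∀ x y → x ≢ y → Meets H ([ a , b ]′ x) ([ a , b ]′ y)) →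
    (∀ i → Useful H (a i) (b i)) →
    Σ (Fin (Hypergraph.m H) → Fin n) (λ c → ProperColouring H c × AtMostTwoPerColour H c)
proposition5p3 n H _ a b ab-inj ab-intersecting useful =
  pairs⇒colouring H g x g-injective x-injective g≢x x-avoids-g (m≤n+m∸n (e H) n)
  where open UsefulPairs H a b ab-inj ab-intersecting useful
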